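{- Let $r,t$ be positive integers. If an $r$-graph $\mathcal{H}$ with at least $t$ edges is $\mathscr{G}_r(tr-r,\,t)$-free, then it is also $\mathscr{G}_r(sr-r,\,s)$-free for every integer $1\le s\le t$.
   Context: An $r$-graph is a family of distinct $r$-element subsets (edges) of a finite vertex set. For integers $v,e$, an $r$-graph is $\mathscr{G}_r(v,e)$-free if the union of any $e$ distinct edges contains at least $v+1$ vertices. -}

module Defs where

open import Data.Nat using (ℕ; suc; _≤_)
open import Data.Fin using (Fin)
open import Data.Fin.Subset using (Subset; ∣_∣; ⋃)
open import Data.List using (List)
open import Data.Vec.Functional using (toList)
open import Function.Definitions using (Injective)
open import Relation.Binary.PropositionalEquality using (_≡_)

record RGraph (r n m : ℕ) : Set where
  field
    edge       : Fin m → Subset n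
    edge-size  : ∀ i → ∣ edge i ∣ ≡ r
    edge-inj   : Injective _≡_ _≡_ edge

unionOf : ∀ {n m e} → (Fin m → Subset n) → (Fin e → Fin m) → Subset n
unionOf E σ = ⋃ (toList (λ j → E (σ j)))

-- G_r(v,e)-free: the union of any e distinct edges has at least v+1 vertices.
-- "e distinct edges" = an injective choice Fin e → Fin m of edge indices.
GFree : ∀ {r n m} → RGraph r n m → ℕ → ℕ → Set
GFree {n = n} {m} H v e =
  (σ : Fin e → Fin m) → Injective _≡_ _≡_ σ →
  suc v ≤ ∣ unionOf (RGraph.edge H) σ ∣

module Submission where

-- Write U(σ) for the union of the edges chosen by an injective
-- σ : Fin e → Fin m.  If e < m, some edge index k is missed by σ, and
-- adjoining edge k to σ gives e+1 distinct edges whose union is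
-- edge k ∪ U(σ), of size at most r + ∣U(σ)∣.  Hence a lower bound v + r + 1
-- on unions of e+1 distinct edges yields the lower bound v + 1 on unions of
-- e distinct edges: G(v + r, e + 1)-freeness implies G(v, e)-freeness when
-- e < m.  Along the family v = e·r − r this says that G(er − r, e)-freeness
-- descends from e+1 to e whenever 1 ≤ e < m, and a downward induction from
-- t ≤ m reaches every s with 1 ≤ s ≤ t.

open import Defs
open import Data.Nat using (ℕ; suc; _+_; _*_; _∸_; _≤_; _<_; _≤′_; ≤′-reflexive; ≤′-step; s≤s; z≤n)
open import Data.Nat.Properties
  using (≤-refl; ≤-trans; ≤-reflexive; n≤1+n; m≤n⇒m≤1+n; +-suc; +-monoʳ-≤; +-cancelˡ-≤; m+n∸m≡n; <⇒≱; ≤⇒≤′; ≤′⇒≤)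
open import Data.Fin as Fin using (Fin)
open import Data.Fin.Properties using (any?; all?; ¬∀⟶∃¬; injective⇒≤)
open import Data.Fin.Subset using (Subset; ∣_∣; _∪_; inside; outside)
open import Data.Vec using ([]; _∷_)
open import Data.Vec.Functional as Vector using ()
open import Data.Product using (∃; _,_; proj₁; proj₂)
open import Data.Empty using (⊥-elim)
open import Relation.Nullary using (yes; no)
open import Relation.Binary.PropositionalEquality using (_≡_; _≢_; refl; sym; trans; cong; subst)
open import Function.Definitions using (Injective)

∣p∪q∣≤∣p∣+∣q∣ : ∀ {n} (p q : Subset n) → ∣ p ∪ q ∣ ≤ ∣ p ∣ + ∣ q ∣
∣p∪q∣≤∣p∣+∣q∣ []           []           = z≤n
∣p∪q∣≤∣p∣+∣q∣ (inside ∷ p)  (inside ∷ q)  = s≤s (≤-trans (∣p∪q∣≤∣p∣+∣q∣ p q) (+-monoʳ-≤ ∣ p ∣ (n≤1+n ∣ q ∣)))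
∣p∪q∣≤∣p∣+∣q∣ (inside ∷ p)  (outside ∷ q) = s≤s (∣p∪q∣≤∣p∣+∣q∣ p q)
∣p∪q∣≤∣p∣+∣q∣ (outside ∷ p) (inside ∷ q)  = subst (∣ p ∪ q ∣ <_) (sym (+-suc ∣ p ∣ ∣ q ∣)) (s≤s (∣p∪q∣≤∣p∣+∣q∣ p q))
∣p∪q∣≤∣p∣+∣q∣ (outside ∷ p) (outside ∷ q) = ∣p∪q∣≤∣p∣+∣q∣ p q

-- An injection Fin s → Fin m with s < m misses some element: otherwise
-- choosing a preimage of every k gives an injection Fin m → Fin s.
missed : ∀ {s m} (σ : Fin s → Fin m) → Injective _≡_ _≡_ σ → s < m →
         ∃ λ k → ∀ j → σ j ≢ k
missed {s} {m} σ σ-inj s<m with all? (λ k → any? (λ j → σ j Fin.≟ k))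
... | yes surjective = ⊥-elim (<⇒≱ s<m (injective⇒≤ preimage-injective))
  where
  preimage : Fin m → Fin s
  preimage k = proj₁ (surjective k)

  preimage-injective : Injective _≡_ _≡_ preimage
  preimage-injective {a} {b} eq =
    trans (sym (proj₂ (surjective a))) (trans (cong σ eq) (proj₂ (surjective b)))
... | no ¬surjective with ¬∀⟶∃¬ m _ (λ k → any? (λ j → σ j Fin.≟ k)) ¬surjective
...   | k , unhit = k , λ j σj≡k → unhit (j , σj≡k)

∷-injective : ∀ {e m} {k : Fin m} {σ : Fin e → Fin m} →
              (∀ j → σ j ≢ k) → Injective _≡_ _≡_ σ →
              Injective _≡_ _≡_ (k Vector.∷ σ)
∷-injective k∉σ σ-inj {Fin.zero}  {Fin.zero}  _  = refl
∷-injective k∉σ σ-inj {Fin.zero}  {Fin.suc y} eq = ⊥-elim (k∉σ y (sym eq))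
∷-injective k∉σ σ-inj {Fin.suc x} {Fin.zero}  eq = ⊥-elim (k∉σ x eq)
∷-injective k∉σ σ-inj {Fin.suc x} {Fin.suc y} eq = cong Fin.suc (σ-inj eq)

-- One step down: in an r-graph with more than e edges, G(r + v, e+1)-freeness
-- implies G(v, e)-freeness, because an extra edge adds at most r vertices.
GFree-step : ∀ {r n m} (H : RGraph r n m) {v e} → e < m →
             GFree H (r + v) (suc e) → GFree H v e
GFree-step {r} H {v} e<m free σ σ-inj with missed σ σ-inj e<m
... | k , k∉σ = +-cancelˡ-≤ r (suc v) ∣ U ∣ r+v<r+∣U∣
  where
  open RGraph H
  U : Subset _
  U = unionOf edge σ

  -- unionOf edge (k ∷ σ) is definitionally edge k ∪ U.
  r+v<r+∣U∣ : r + suc v ≤ r + ∣ U ∣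
  r+v<r+∣U∣ = subst (_≤ r + ∣ U ∣) (sym (+-suc r v))
    (≤-trans (free (k Vector.∷ σ) (∷-injective k∉σ σ-inj))
    (≤-trans (∣p∪q∣≤∣p∣+∣q∣ (edge k) U)
             (≤-reflexive (cong (_+ ∣ U ∣) (edge-size k)))))

GFree-family-step : ∀ {r n m} (H : RGraph r n m) {e} → 1 ≤ e → e < m →
                    GFree H (suc e * r ∸ r) (suc e) → GFree H (e * r ∸ r) e
GFree-family-step {r} H {suc e} _ e<m free =
  GFree-step H e<m (subst (λ v → GFree H v (suc (suc e))) (sym shift) free)
  where
  -- (e+2)r − r = (e+1)r = r + ((e+1)r − r)
  shift : r + (suc e * r ∸ r) ≡ suc (suc e) * r ∸ r
  shift = trans (cong (r +_) (m+n∸m≡n r (e * r))) (sym (m+n∸m≡n r (suc e * r)))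

downward-induction : ∀ {ℓ} (P : ℕ → Set ℓ) {s t} → s ≤′ t →
                     (∀ {e} → s ≤ e → e < t → P (suc e) → P e) → P t → P s
downward-induction P (≤′-reflexive refl) step Pt = Pt
downward-induction P (≤′-step {t} s≤′t) step Pt =
  downward-induction P s≤′t (λ s≤e e<t → step s≤e (m≤n⇒m≤1+n e<t))
    (step (≤′⇒≤ s≤′t) ≤-refl Pt)

fact1 : (r t n m : ℕ) → 1 ≤ r → 1 ≤ t →
        (H : RGraph r n m) → t ≤ m →
        GFree H (t * r ∸ r) t →
        (s : ℕ) → 1 ≤ s → s ≤ t → GFree H (s * r ∸ r) s
fact1 r t n m _ _ H t≤m free s 1≤s s≤t =
  downward-induction (λ e → GFree H (e * r ∸ r) e) (≤⇒≤′ s≤t)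
    (λ s≤e e<t → GFree-family-step H (≤-trans 1≤s s≤e) (≤-trans e<t t≤m))
    free
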